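{- For every integer $n\geq 2$, $\lceil \log_2 n\rceil \leq \mathrm{sat}^*(n,\mathcal{D}_2)\leq n+1$.
   Context: $\mathcal{D}_2$ (the diamond) is the four-element poset $\{a,b,c,d\}$ with $a<b<d$, $a<c<d$ and $b,c$ incomparable. $\mathcal{B}_n$ is the Boolean lattice $(2^{[n]},\subseteq)$. A poset $\mathcal{P}'=(P',\le')$ is an induced subposet of $\mathcal{P}=(P,\le)$ if there is an injection $f:P'\to P$ with $u\le' v$ iff $f(u)\le f(v)$. A family $\mathcal{F}\subseteq 2^{[n]}$ (ordered by inclusion) is induced-$\mathcal{P}$-saturated in $\mathcal{B}_n$ if it contains no induced copy of $\mathcal{P}$, but every $\mathcal{F}'$ with $\mathcal{F}\subsetneq\mathcal{F}'\subseteq 2^{[n]}$ contains an induced copy of $\mathcal{P}$. $\mathrm{sat}^*(n,\mathcal{P})$ is the minimum size of an induced-$\mathcal{P}$-saturated family in $\mathcal{B}_n$. -}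

module Defs where

open import Data.Nat using (ℕ; zero; suc)
open import Data.Bool using (Bool; true; false)
open import Data.Fin using (Fin; zero; suc)
open import Data.Fin.Subset using (Subset; _⊆_)
open import Data.Vec using (_∷_; [])
open import Data.List using (List; []; _∷_; map; _++_; length; filterᵇ)
open import Data.Product using (Σ; _×_; _,_; ∃)
open import Relation.Binary.PropositionalEquality using (_≡_)
open import Relation.Nullary using (¬_)
open import Function.Definitions using (Injective)

-- The diamond poset D₂ on Fin 4: 0 = a, 1 = b, 2 = c, 3 = d,
-- with a < b < d, a < c < d, b and c incomparable.

a b c d : Fin 4
a = zero
b = suc zero
c = suc (suc zero)
d = suc (suc (suc zero))

D₂≤ᵇ : Fin 4 → Fin 4 → Bool
D₂≤ᵇ zero _ = true
D₂≤ᵇ (suc zero) (suc zero) = true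
D₂≤ᵇ (suc zero) (suc (suc (suc zero))) = true
D₂≤ᵇ (suc (suc zero)) (suc (suc zero)) = true
D₂≤ᵇ (suc (suc zero)) (suc (suc (suc zero))) = true
D₂≤ᵇ (suc (suc (suc zero))) (suc (suc (suc zero))) = true
D₂≤ᵇ _ _ = false

_≤D₂_ : Fin 4 → Fin 4 → Set
u ≤D₂ v = D₂≤ᵇ u v ≡ true

Family : ℕ → Set
Family n = Subset n → Bool

_∈F_ : ∀ {n} → Subset n → Family n → Set
S ∈F F = F S ≡ true

_⊆F_ : ∀ {n} → Family n → Family n → Set
F ⊆F G = ∀ S → S ∈F F → S ∈F G

_⊊F_ : ∀ {n} → Family n → Family n → Set
F ⊊F G = F ⊆F G × ∃ λ S → S ∈F G × ¬ (S ∈F F)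

InducedD₂ : ∀ {n} → Family n → Set
InducedD₂ {n} F =
  Σ (Fin 4 → Subset n) λ f →
    (∀ u → f u ∈F F) ×
    Injective _≡_ _≡_ f ×
    (∀ u v → (u ≤D₂ v → f u ⊆ f v) × (f u ⊆ f v → u ≤D₂ v))

Saturated : ∀ {n} → Family n → Set
Saturated {n} F =
  ¬ InducedD₂ F × (∀ (G : Family n) → F ⊊F G → InducedD₂ G)

allSubsets : (n : ℕ) → List (Subset n)
allSubsets zero = [] ∷ []
allSubsets (suc n) =
  map (true ∷_) (allSubsets n) ++ map (false ∷_) (allSubsets n)

size : ∀ {n} → Family n → ℕ
size {n} F = length (filterᵇ F (allSubsets n))

-- Lower bound: a saturated family F separates any two points i ≠ j of [n], so i ↦ (i ∈ W)_{W ∈ F}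
-- is an injection [n] → 2^|F|, whence n ≤ 2^|F|. Were i ≠ j never separated, take L maximal among
-- the members of F avoiding i: then S = L ∪ {i} is not in F (it contains i but not j), and every
-- member of F below, above or incomparable to S is respectively below, above or incomparable to L.
-- Adding S to F creates a diamond, and replacing S by L in it gives a diamond inside F. (If every
-- member contains i, use H − j for a minimal member H containing i.)
--
-- Upper bound: the chain ∅ ⊂ {0} ⊂ {0,1} ⊂ ⋯ ⊂ [n] has n + 1 members and no diamond, and any other
-- set S lies in the diamond A ⊆ S, C ⊆ [n], where A is the largest initial segment inside S and C
-- the next one.

module Submission where

open import Defs
open import Data.Bool using (Bool; true; false; _∨_; T)
import Data.Bool.Properties as Bool
open import Data.Empty using (⊥-elim)
open import Data.Fin using (Fin; zero; suc; funToFin; finToFun)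
open import Data.Fin.Properties using (¬∀⟶∃¬; injective⇒≤; finToFun-funToFin; 2↔Bool)
  renaming (_≟_ to _≟ᶠ_)
open import Data.Fin.Subset
  using (Subset; inside; outside; _∈_; _∉_; _⊆_; _⊈_; _⊂_; _⊃_; _∪_; _-_; ⁅_⁆; ⊥; ⊤; Nonempty)
open import Data.Fin.Subset.Properties
  using ( _∈?_; _⊆?_; _⊂?_; anySubset?; ⊆-refl; ⊆-trans; ⊆-reflexive; s⊆s; out⊆; drop-∷-⊆
        ; ⊥⊆; ∉⊥; ⊆⊤; x∈⁅x⁆; x∈⁅y⁆⇒x≡y; p⊆p∪q; q⊆p∪q; x∈p∪q⁻; p─q⊆p; x∈p∧x≢y⇒x∈p-y)
open import Data.Fin.Subset.Induction using (⊂-wellFounded; ⊃-wellFounded)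
open import Data.List using (List; []; _∷_; map; _++_; length; filterᵇ)
import Data.List as List
open import Data.List.Properties using (filter-++; length-++)
open import Data.List.Membership.Propositional using () renaming (_∈_ to _∈ˡ_)
open import Data.List.Membership.Propositional.Properties using (∈-map⁺; ∈-++⁺ˡ; ∈-++⁺ʳ; ∈-filter⁺)
open import Data.List.Relation.Unary.Any using (here; index)
open import Data.List.Relation.Unary.Any.Properties using (lookup-index)
open import Data.Nat using (ℕ; zero; suc; _≤_; _+_; _^_)
open import Data.Nat.Properties using (+-comm; ≤-reflexive; module ≤-Reasoning)
open import Data.Nat.Logarithm using (⌈log₂_⌉; ⌈log₂⌉-mono-≤; ⌈log₂2^n⌉≡n)
open import Data.Product using (Σ; ∃; ∃₂; _×_; _,_; proj₁; proj₂)
open import Data.Sum using (_⊎_; inj₁; inj₂; [_,_])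
import Data.Sum as Sum
open import Data.Unit using (tt)
open import Data.Vec using ([]; _∷_; lookup; here; there)
open import Data.Vec.Properties using (≡-dec; []=⇒lookup; lookup⇒[]=)
open import Function using (_∘_)
open import Level using (0ℓ)
open import Function.Bundles using (Injection)
open import Function.Definitions using (Injective)
open import Function.Properties.Inverse using (↔-sym; ↔⇒↣)
open import Induction.WellFounded using (Acc; acc)
open import Relation.Binary.PropositionalEquality
  using (_≡_; _≢_; refl; sym; trans; cong; cong₂; subst; subst₂; module ≡-Reasoning)
open import Relation.Nullary using (¬_; ¬?; Dec; yes; no; does; contradiction; _×-dec_; _→-dec_)
open import Relation.Nullary.Decidable using (decidable-stable; T?)
open import Relation.Unary using (Pred; Decidable)

private
  variable
    n : ℕ
    F : Family n
    X Y : Subset n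

_≟ˢ_ : (X Y : Subset n) → Dec (X ≡ Y)
_≟ˢ_ = ≡-dec Bool._≟_

_∈F?_ : (X : Subset n) (F : Family n) → Dec (X ∈F F)
X ∈F? F = F X Bool.≟ true

_∥_ : Subset n → Subset n → Set
X ∥ Y = X ⊈ Y × Y ⊈ X

∥-sym : X ∥ Y → Y ∥ X
∥-sym (X⊈Y , Y⊈X) = Y⊈X , X⊈Y

∥-irrefl : ¬ X ∥ X
∥-irrefl (X⊈X , _) = X⊈X ⊆-refl

∷-∥ : ∀ {s} → X ∥ Y → (s ∷ X) ∥ (s ∷ Y)
∷-∥ (X⊈Y , Y⊈X) = X⊈Y ∘ drop-∷-⊆ , Y⊈X ∘ drop-∷-⊆

⊆∧⊉⇒⊂ : X ⊆ Y → Y ⊈ X → X ⊂ Y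
⊆∧⊉⇒⊂ {n} {X} {Y} X⊆Y Y⊈X
  with z , z∈Y⇏z∈X ← ¬∀⟶∃¬ n (λ z → z ∈ Y → z ∈ X) (λ z → z ∈? Y →-dec z ∈? X) (λ h → Y⊈X (h _))
     | z ∈? Y
... | yes z∈Y = X⊆Y , z , z∈Y , λ z∈X → z∈Y⇏z∈X (λ _ → z∈X)
... | no z∉Y = contradiction (λ z∈Y → contradiction z∈Y z∉Y) z∈Y⇏z∈X

x∉p-x : ∀ (p : Subset n) x → x ∉ p - x
x∉p-x (_ ∷ p) zero ()
x∉p-x (_ ∷ p) (suc x) (there x∈p-x) = x∉p-x p x x∈p-x

lookup≡⇒∈⇔∈ : ∀ {i j} → lookup X i ≡ lookup X j → (i ∈ X → j ∈ X) × (j ∈ X → i ∈ X)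
lookup≡⇒∈⇔∈ {X = X} {i} {j} eq =
  (λ i∈X → lookup⇒[]= j X (trans (sym eq) ([]=⇒lookup i∈X))) ,
  (λ j∈X → lookup⇒[]= i X (trans eq ([]=⇒lookup j∈X)))

module _ {P : Pred (Subset n) 0ℓ} (P? : Decidable P) where

  maximal-exists : P X → ∃ λ M → P M × (∀ {Y} → P Y → M ⊆ Y → Y ⊆ M)
  maximal-exists = go (⊃-wellFounded _)
    where
    go : ∀ {M} → Acc _⊃_ M → P M → ∃ λ M → P M × (∀ {Y} → P Y → M ⊆ Y → Y ⊆ M)
    go {M} (acc rec) PM with anySubset? (λ Y → P? Y ×-dec M ⊂? Y)
    ... | yes (Y , PY , M⊂Y) = go (rec M⊂Y) PY
    ... | no ∄Y = M , PM , λ {Y} PY M⊆Y →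
      decidable-stable (Y ⊆? M) (λ Y⊈M → ∄Y (Y , PY , ⊆∧⊉⇒⊂ M⊆Y Y⊈M))

  minimal-exists : P X → ∃ λ M → P M × (∀ {Y} → P Y → Y ⊆ M → M ⊆ Y)
  minimal-exists = go (⊂-wellFounded _)
    where
    go : ∀ {M} → Acc _⊂_ M → P M → ∃ λ M → P M × (∀ {Y} → P Y → Y ⊆ M → M ⊆ Y)
    go {M} (acc rec) PM with anySubset? (λ Y → P? Y ×-dec Y ⊂? M)
    ... | yes (Y , PY , Y⊂M) = go (rec Y⊂M) PY
    ... | no ∄Y = M , PM , λ {Y} PY Y⊆M →
      decidable-stable (M ⊆? Y) (λ M⊈Y → ∄Y (Y , PY , ⊆∧⊉⇒⊂ Y⊆M M⊈Y))

≤D₂-antisym : ∀ u v → u ≤D₂ v → v ≤D₂ u → u ≡ v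
≤D₂-antisym zero                   zero                   _ _ = refl
≤D₂-antisym (suc zero)             (suc zero)             _ _ = refl
≤D₂-antisym (suc (suc zero))       (suc (suc zero))       _ _ = refl
≤D₂-antisym (suc (suc (suc zero))) (suc (suc (suc zero))) _ _ = refl
≤D₂-antisym zero                   (suc zero)             _ ()
≤D₂-antisym zero                   (suc (suc zero))       _ ()
≤D₂-antisym zero                   (suc (suc (suc zero))) _ ()
≤D₂-antisym (suc zero)             (suc (suc (suc zero))) _ ()
≤D₂-antisym (suc (suc zero))       (suc (suc (suc zero))) _ ()
≤D₂-antisym (suc zero)             zero                   ()
≤D₂-antisym (suc zero)             (suc (suc zero))       ()
≤D₂-antisym (suc (suc zero))       zero                   ()
≤D₂-antisym (suc (suc zero))       (suc zero)             ()
≤D₂-antisym (suc (suc (suc zero))) zero                   ()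
≤D₂-antisym (suc (suc (suc zero))) (suc zero)             ()
≤D₂-antisym (suc (suc (suc zero))) (suc (suc zero))       ()

record Diamond (F : Family n) : Set where
  field
    bottom left right top : Subset n
    bottom∈F : bottom ∈F F
    left∈F   : left ∈F F
    right∈F  : right ∈F F
    top∈F    : top ∈F F
    bottom⊆left  : bottom ⊆ left
    bottom⊆right : bottom ⊆ right
    left⊆top     : left ⊆ top
    right⊆top    : right ⊆ top
    left∥right   : left ∥ right

InducedD₂⇒Diamond : InducedD₂ F → Diamond F
InducedD₂⇒Diamond (f , f∈F , _ , order) = record
  { bottom = f a ; left = f b ; right = f c ; top = f d
  ; bottom∈F = f∈F a ; left∈F = f∈F b ; right∈F = f∈F c ; top∈F = f∈F d
  ; bottom⊆left  = proj₁ (order a b) refl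
  ; bottom⊆right = proj₁ (order a c) refl
  ; left⊆top     = proj₁ (order b d) refl
  ; right⊆top    = proj₁ (order c d) refl
  ; left∥right   = (λ b⊆c → contradiction (proj₂ (order b c) b⊆c) λ ()) ,
                   (λ c⊆b → contradiction (proj₂ (order c b) c⊆b) λ ())
  }

Diamond⇒InducedD₂ : Diamond F → InducedD₂ F
Diamond⇒InducedD₂ {n} {F} δ = vertex , vertex∈F , vertex-injective , λ u v → monotone u v , reflecting u v
  where
  open Diamond δ

  vertex : Fin 4 → Subset n
  vertex zero                   = bottom
  vertex (suc zero)             = left
  vertex (suc (suc zero))       = right
  vertex (suc (suc (suc zero))) = top

  vertex∈F : ∀ u → vertex u ∈F F
  vertex∈F zero                   = bottom∈F
  vertex∈F (suc zero)             = left∈F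
  vertex∈F (suc (suc zero))       = right∈F
  vertex∈F (suc (suc (suc zero))) = top∈F

  monotone : ∀ u v → u ≤D₂ v → vertex u ⊆ vertex v
  monotone zero                   zero                   _ = ⊆-refl
  monotone zero                   (suc zero)             _ = bottom⊆left
  monotone zero                   (suc (suc zero))       _ = bottom⊆right
  monotone zero                   (suc (suc (suc zero))) _ = ⊆-trans bottom⊆left left⊆top
  monotone (suc zero)             (suc zero)             _ = ⊆-refl
  monotone (suc zero)             (suc (suc (suc zero))) _ = left⊆top
  monotone (suc (suc zero))       (suc (suc zero))       _ = ⊆-refl
  monotone (suc (suc zero))       (suc (suc (suc zero))) _ = right⊆top
  monotone (suc (suc (suc zero))) (suc (suc (suc zero))) _ = ⊆-refl
  monotone (suc zero)             zero                   ()
  monotone (suc zero)             (suc (suc zero))       ()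
  monotone (suc (suc zero))       zero                   ()
  monotone (suc (suc zero))       (suc zero)             ()
  monotone (suc (suc (suc zero))) zero                   ()
  monotone (suc (suc (suc zero))) (suc zero)             ()
  monotone (suc (suc (suc zero))) (suc (suc zero))       ()

  left⊈right : left ⊈ right
  left⊈right = proj₁ left∥right

  right⊈left : right ⊈ left
  right⊈left = proj₂ left∥right

  reflecting : ∀ u v → vertex u ⊆ vertex v → u ≤D₂ v
  reflecting zero                   _                      _ = refl
  reflecting (suc zero)             (suc zero)             _ = refl
  reflecting (suc zero)             (suc (suc (suc zero))) _ = refl
  reflecting (suc (suc zero))       (suc (suc zero))       _ = refl
  reflecting (suc (suc zero))       (suc (suc (suc zero))) _ = refl
  reflecting (suc (suc (suc zero))) (suc (suc (suc zero))) _ = refl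
  reflecting (suc zero)             zero                   p = ⊥-elim (left⊈right (⊆-trans p bottom⊆right))
  reflecting (suc zero)             (suc (suc zero))       p = ⊥-elim (left⊈right p)
  reflecting (suc (suc zero))       zero                   p = ⊥-elim (right⊈left (⊆-trans p bottom⊆left))
  reflecting (suc (suc zero))       (suc zero)             p = ⊥-elim (right⊈left p)
  reflecting (suc (suc (suc zero))) zero                   p = ⊥-elim (left⊈right (⊆-trans left⊆top (⊆-trans p bottom⊆right)))
  reflecting (suc (suc (suc zero))) (suc zero)             p = ⊥-elim (right⊈left (⊆-trans right⊆top p))
  reflecting (suc (suc (suc zero))) (suc (suc zero))       p = ⊥-elim (left⊈right (⊆-trans left⊆top p))

  vertex-injective : Injective _≡_ _≡_ vertex
  vertex-injective {u} {v} eq =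
    ≤D₂-antisym u v (reflecting u v (⊆-reflexive eq)) (reflecting v u (⊆-reflexive (sym eq)))

-- Sets mimicked by a member

insert : Subset n → Family n → Family n
insert S F X = F X ∨ does (X ≟ˢ S)

∈insert⁻ : ∀ (F : Family n) {S} → X ∈F insert S F → X ≢ S → X ∈F F
∈insert⁻ {X = X} F {S} X∈ X≢S with F X | X ≟ˢ S
... | true  | _        = refl
... | false | yes X≡S  = contradiction X≡S X≢S
... | false | no _     = X∈

⊊insert : ∀ {S} → ¬ S ∈F F → F ⊊F insert S F
⊊insert {F = F} {S} S∉F = F⊆ , S , S∈ , S∉F
  where
  F⊆ : F ⊆F insert S F
  F⊆ X X∈F rewrite X∈F = refl
  S∈ : S ∈F insert S F
  S∈ with S ≟ˢ S
  ... | yes _   = Bool.∨-zeroʳ (F S)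
  ... | no S≢S  = contradiction refl S≢S

Diamond-insert⇒member : ∀ {S} → Diamond (insert S F) → ∃ λ W → W ∈F F
Diamond-insert⇒member {F = F} {S} δ = member (left ≟ˢ S) (right ≟ˢ S)
  where
  open Diamond δ
  member : Dec (left ≡ S) → Dec (right ≡ S) → ∃ λ W → W ∈F F
  member (no left≢S)  _             = left , ∈insert⁻ F left∈F left≢S
  member (yes _)      (no right≢S)  = right , ∈insert⁻ F right∈F right≢S
  member (yes left≡S) (yes right≡S) = ⊥-elim (∥-irrefl (subst₂ _∥_ left≡S right≡S left∥right))

record Mimics (F : Family n) (S E : Subset n) : Set where
  field
    below : ∀ {W} → W ∈F F → W ⊆ S → W ⊆ E
    above : ∀ {W} → W ∈F F → S ⊆ W → E ⊆ W
    apart : ∀ {W} → W ∈F F → S ∥ W → E ∥ W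

Diamond-map : ∀ {G : Family n} (r : Subset n → Subset n) →
              (∀ {X} → X ∈F G → r X ∈F F) →
              (∀ {X Y} → X ∈F G → Y ∈F G → X ⊆ Y → r X ⊆ r Y) →
              (∀ {X Y} → X ∈F G → Y ∈F G → X ∥ Y → r X ∥ r Y) →
              Diamond G → Diamond F
Diamond-map r r-∈ r-⊆ r-∥ δ = record
  { bottom = r bottom ; left = r left ; right = r right ; top = r top
  ; bottom∈F = r-∈ bottom∈F ; left∈F = r-∈ left∈F ; right∈F = r-∈ right∈F ; top∈F = r-∈ top∈F
  ; bottom⊆left  = r-⊆ bottom∈F left∈F bottom⊆left
  ; bottom⊆right = r-⊆ bottom∈F right∈F bottom⊆right
  ; left⊆top     = r-⊆ left∈F top∈F left⊆top
  ; right⊆top    = r-⊆ right∈F top∈F right⊆top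
  ; left∥right   = r-∥ left∈F right∈F left∥right
  }
  where open Diamond δ

replace : Subset n → Subset n → Subset n → Subset n
replace S E X with X ≟ˢ S
... | yes _ = E
... | no _  = X

Diamond-insert : ∀ {S E} → E ∈F F → Mimics F S E → Diamond (insert S F) → Diamond F
Diamond-insert {F = F} {S} {E} E∈F mimics =
  Diamond-map (replace S E)
    (λ X∈ → replace-∈ (∈insert⁻ F X∈))
    (λ X∈ Y∈ → replace-⊆ (∈insert⁻ F X∈) (∈insert⁻ F Y∈))
    (λ X∈ Y∈ → replace-∥ (∈insert⁻ F X∈) (∈insert⁻ F Y∈))
  where
  open Mimics mimics

  -- Membership in insert S F is passed on as X ≢ S → X ∈F F: under with X ≟ˢ S the type of a
  -- proof of X ∈F insert S F would be rewritten too.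
  replace-∈ : (X ≢ S → X ∈F F) → replace S E X ∈F F
  replace-∈ {X} X∈ with X ≟ˢ S
  ... | yes _   = E∈F
  ... | no X≢S  = X∈ X≢S

  replace-⊆ : (X ≢ S → X ∈F F) → (Y ≢ S → Y ∈F F) → X ⊆ Y → replace S E X ⊆ replace S E Y
  replace-⊆ {X} {Y} X∈ Y∈ X⊆Y with X ≟ˢ S | Y ≟ˢ S
  ... | yes _    | yes _    = ⊆-refl
  ... | yes refl | no Y≢S   = above (Y∈ Y≢S) X⊆Y
  ... | no X≢S   | yes refl = below (X∈ X≢S) X⊆Y
  ... | no _     | no _     = X⊆Y

  replace-∥ : (X ≢ S → X ∈F F) → (Y ≢ S → Y ∈F F) → X ∥ Y → replace S E X ∥ replace S E Y
  replace-∥ {X} {Y} X∈ Y∈ X∥Y with X ≟ˢ S | Y ≟ˢ S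
  ... | yes refl | yes refl = ⊥-elim (∥-irrefl X∥Y)
  ... | yes refl | no Y≢S   = apart (Y∈ Y≢S) X∥Y
  ... | no X≢S   | yes refl = ∥-sym (apart (X∈ X≢S) (∥-sym X∥Y))
  ... | no _     | no _     = X∥Y

Saturated⇒¬Mimics : ∀ {S E} → Saturated F → ¬ S ∈F F → E ∈F F → ¬ Mimics F S E
Saturated⇒¬Mimics (D₂-free , extensions) S∉F E∈F mimics =
  D₂-free (Diamond⇒InducedD₂ (Diamond-insert E∈F mimics
    (InducedD₂⇒Diamond (extensions _ (⊊insert S∉F)))))

Saturated⇒nonempty : Saturated F → ∃ λ W → W ∈F F
Saturated⇒nonempty {F = F} (_ , extensions) with ⊥ ∈F? F
... | yes ⊥∈F = ⊥ , ⊥∈F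
... | no ⊥∉F  = Diamond-insert⇒member (InducedD₂⇒Diamond (extensions _ (⊊insert ⊥∉F)))

-- Saturated families separate points

Twins : Family n → Fin n → Fin n → Set
Twins F i j = ∀ {W} → W ∈F F → (i ∈ W → j ∈ W) × (j ∈ W → i ∈ W)

module _ {F : Family n} {i j : Fin n} (i≢j : i ≢ j) (twins : Twins F i j) where

  ∪⁅⁆-mimics : ∀ {L} → L ∈F F → i ∉ L → (∀ {X} → X ∈F F × i ∉ X → L ⊆ X → X ⊆ L) →
               ¬ (L ∪ ⁅ i ⁆) ∈F F × Mimics F (L ∪ ⁅ i ⁆) L
  ∪⁅⁆-mimics {L} L∈F i∉L L-maximal = S∉F , record { below = below ; above = above ; apart = apart }
    where
    S : Subset n
    S = L ∪ ⁅ i ⁆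

    L⊆S : L ⊆ S
    L⊆S = p⊆p∪q ⁅ i ⁆

    i∈S : i ∈ S
    i∈S = q⊆p∪q L ⁅ i ⁆ (x∈⁅x⁆ i)

    ∈S⇒∈L : ∀ {x} → x ∈ S → x ≢ i → x ∈ L
    ∈S⇒∈L x∈S x≢i =
      [ (λ x∈L → x∈L) , (λ x∈⁅i⁆ → contradiction (x∈⁅y⁆⇒x≡y i x∈⁅i⁆) x≢i) ] (x∈p∪q⁻ L ⁅ i ⁆ x∈S)

    j∉S : j ∉ S
    j∉S j∈S = i∉L (proj₂ (twins L∈F) (∈S⇒∈L j∈S (i≢j ∘ sym)))

    S∉F : ¬ S ∈F F
    S∉F S∈F = j∉S (proj₁ (twins S∈F) i∈S)

    below : ∀ {W} → W ∈F F → W ⊆ S → W ⊆ L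
    below W∈F W⊆S {x} x∈W = ∈S⇒∈L (W⊆S x∈W) λ { refl → j∉S (W⊆S (proj₁ (twins W∈F) x∈W)) }

    above : ∀ {W} → W ∈F F → S ⊆ W → L ⊆ W
    above _ S⊆W = ⊆-trans L⊆S S⊆W

    apart : ∀ {W} → W ∈F F → S ∥ W → L ∥ W
    apart {W} W∈F (S⊈W , W⊈S) = L⊈W , λ W⊆L → W⊈S (⊆-trans W⊆L L⊆S)
      where
      L⊈W : L ⊈ W
      L⊈W L⊆W with i ∈? W
      ... | no i∉W  = W⊈S (⊆-trans (L-maximal (W∈F , i∉W) L⊆W) L⊆S)
      ... | yes i∈W = S⊈W S⊆W
        where
        S⊆W : S ⊆ W
        S⊆W {x} x∈S with x ≟ᶠ i
        ... | yes refl = i∈W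
        ... | no x≢i   = L⊆W (∈S⇒∈L x∈S x≢i)

  -⁅⁆-mimics : ∀ {H} → H ∈F F → i ∈ H → (∀ {X} → X ∈F F × i ∈ X → X ⊆ H → H ⊆ X) →
               ¬ (H - j) ∈F F × Mimics F (H - j) H
  -⁅⁆-mimics {H} H∈F i∈H H-minimal = S∉F , record { below = below ; above = above ; apart = apart }
    where
    S : Subset n
    S = H - j

    S⊆H : S ⊆ H
    S⊆H = p─q⊆p H ⁅ j ⁆

    i∈S : i ∈ S
    i∈S = x∈p∧x≢y⇒x∈p-y i∈H i≢j

    S∉F : ¬ S ∈F F
    S∉F S∈F = x∉p-x H j (proj₁ (twins S∈F) i∈S)

    below : ∀ {W} → W ∈F F → W ⊆ S → W ⊆ H
    below _ W⊆S = ⊆-trans W⊆S S⊆H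

    above : ∀ {W} → W ∈F F → S ⊆ W → H ⊆ W
    above W∈F S⊆W {x} x∈H with x ≟ᶠ j
    ... | yes refl = proj₁ (twins W∈F) (S⊆W i∈S)
    ... | no x≢j   = S⊆W (x∈p∧x≢y⇒x∈p-y x∈H x≢j)

    apart : ∀ {W} → W ∈F F → S ∥ W → H ∥ W
    apart {W} W∈F (S⊈W , W⊈S) = (λ H⊆W → S⊈W (⊆-trans S⊆H H⊆W)) , W⊈H
      where
      W⊈H : W ⊈ H
      W⊈H W⊆H with i ∈? W
      ... | yes i∈W = S⊈W (⊆-trans S⊆H (H-minimal (W∈F , i∈W) W⊆H))
      ... | no i∉W  = W⊈S λ {x} x∈W →
        x∈p∧x≢y⇒x∈p-y (W⊆H x∈W) λ { refl → i∉W (proj₂ (twins W∈F) x∈W) }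

Saturated⇒twins-equal : ∀ {i j} → Saturated F → Twins F i j → i ≡ j
Saturated⇒twins-equal {F = F} {i = i} {j} saturated twins with i ≟ᶠ j
... | yes i≡j = i≡j
... | no i≢j with W , W∈F ← Saturated⇒nonempty saturated | i ∈? W
...   | no i∉W =
  let L , (L∈F , i∉L) , L-maximal = maximal-exists (λ X → X ∈F? F ×-dec ¬? (i ∈? X)) (W∈F , i∉W)
      S∉F , mimics = ∪⁅⁆-mimics i≢j twins L∈F i∉L L-maximal
  in  ⊥-elim (Saturated⇒¬Mimics saturated S∉F L∈F mimics)
...   | yes i∈W =
  let H , (H∈F , i∈H) , H-minimal = minimal-exists (λ X → X ∈F? F ×-dec i ∈? X) (W∈F , i∈W)
      S∉F , mimics = -⁅⁆-mimics i≢j twins H∈F i∈H H-minimal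
  in  ⊥-elim (Saturated⇒¬Mimics saturated S∉F H∈F mimics)

∈-allSubsets : (W : Subset n) → W ∈ˡ allSubsets n
∈-allSubsets []                  = here refl
∈-allSubsets {suc n} (true ∷ W)  = ∈-++⁺ˡ (∈-map⁺ (true ∷_) (∈-allSubsets W))
∈-allSubsets {suc n} (false ∷ W) = ∈-++⁺ʳ (map (true ∷_) (allSubsets n)) (∈-map⁺ (false ∷_) (∈-allSubsets W))

members : (F : Family n) → Fin (size F) → Subset n
members {n} F = List.lookup (filterᵇ F (allSubsets n))

members-complete : ∀ (F : Family n) {W} → W ∈F F → ∃ λ p → members F p ≡ W
members-complete F {W} W∈F = index W∈members , sym (lookup-index W∈members)
  where
  W∈members : W ∈ˡ filterᵇ F (allSubsets _)
  W∈members = ∈-filter⁺ (T? ∘ F) (∈-allSubsets W) (subst T (sym W∈F) tt)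

funToFin-injective : ∀ {m k} {f g : Fin m → Fin k} → funToFin f ≡ funToFin g → ∀ x → f x ≡ g x
funToFin-injective {f = f} {g} eq x = begin
  f x                        ≡⟨ finToFun-funToFin f x ⟨
  finToFun (funToFin f) x    ≡⟨ cong (λ k → finToFun k x) eq ⟩
  finToFun (funToFin g) x    ≡⟨ finToFun-funToFin g x ⟩
  g x                        ∎
  where open ≡-Reasoning

open Injection (↔⇒↣ (↔-sym 2↔Bool)) using () renaming (to to bit; injective to bit-injective)

signature : (F : Family n) → Fin n → Fin (size F) → Fin 2
signature F i p = bit (lookup (members F p) i)

signature-injective : Saturated F → Injective _≡_ _≡_ (funToFin ∘ signature F)
signature-injective {F = F} saturated {i} {j} eq = Saturated⇒twins-equal saturated twins
  where
  twins : Twins F i j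
  twins W∈F with p , refl ← members-complete F W∈F =
    lookup≡⇒∈⇔∈ (bit-injective (funToFin-injective eq p))

n≤2^size : {F : Family n} → Saturated F → n ≤ 2 ^ size F
n≤2^size saturated = injective⇒≤ (signature-injective saturated)

⌈log₂n⌉≤size : {F : Family n} → Saturated F → ⌈log₂ n ⌉ ≤ size F
⌈log₂n⌉≤size {n} {F} saturated = begin
  ⌈log₂ n ⌉            ≤⟨ ⌈log₂⌉-mono-≤ (n≤2^size saturated) ⟩
  ⌈log₂ (2 ^ size F) ⌉ ≡⟨ ⌈log₂2^n⌉≡n (size F) ⟩
  size F               ∎
  where open ≤-Reasoning

-- The chain of initial segments

size-∷ : (F : Family (suc n)) → size F ≡ size (F ∘ (inside ∷_)) + size (F ∘ (outside ∷_))
size-∷ {n} F = begin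
  length (filterᵇ F (map (inside ∷_) A ++ map (outside ∷_) A))
    ≡⟨ cong length (filter-++ (T? ∘ F) (map (inside ∷_) A) (map (outside ∷_) A)) ⟩
  length (filterᵇ F (map (inside ∷_) A) ++ filterᵇ F (map (outside ∷_) A))
    ≡⟨ length-++ (filterᵇ F (map (inside ∷_) A)) ⟩
  length (filterᵇ F (map (inside ∷_) A)) + length (filterᵇ F (map (outside ∷_) A))
    ≡⟨ cong₂ _+_ (length-filterᵇ-map (inside ∷_) A) (length-filterᵇ-map (outside ∷_) A) ⟩
  size (F ∘ (inside ∷_)) + size (F ∘ (outside ∷_))
    ∎
  where
  open ≡-Reasoning
  A : List (Subset n)
  A = allSubsets n
  length-filterᵇ-map : ∀ (f : Subset n → Subset (suc n)) xs →
                       length (filterᵇ F (map f xs)) ≡ length (filterᵇ (F ∘ f) xs)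
  length-filterᵇ-map f []       = refl
  length-filterᵇ-map f (x ∷ xs) with F (f x)
  ... | true  = cong suc (length-filterᵇ-map f xs)
  ... | false = length-filterᵇ-map f xs

size-∅ : size {n} (λ _ → false) ≡ 0
size-∅ {zero}  = refl
size-∅ {suc n} = trans (size-∷ {n} (λ _ → false)) (cong₂ _+_ (size-∅ {n}) (size-∅ {n}))

emptyᵇ : Subset n → Bool
emptyᵇ []            = true
emptyᵇ (inside ∷ _)  = false
emptyᵇ (outside ∷ X) = emptyᵇ X

size-emptyᵇ : size {n} emptyᵇ ≡ 1
size-emptyᵇ {zero}  = refl
size-emptyᵇ {suc n} = trans (size-∷ {n} emptyᵇ) (cong₂ _+_ (size-∅ {n}) (size-emptyᵇ {n}))

emptyᵇ⇒⊆ : emptyᵇ X ≡ true → X ⊆ Y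
emptyᵇ⇒⊆ {X = outside ∷ X} {_ ∷ Y} X-empty (there x∈X) = there (emptyᵇ⇒⊆ X-empty x∈X)

emptyᵇ-⊥ : emptyᵇ (⊥ {n}) ≡ true
emptyᵇ-⊥ {zero}  = refl
emptyᵇ-⊥ {suc n} = emptyᵇ-⊥ {n}

¬emptyᵇ⇒nonempty : ¬ emptyᵇ X ≡ true → Nonempty X
¬emptyᵇ⇒nonempty {X = []}          X-nonempty = contradiction refl X-nonempty
¬emptyᵇ⇒nonempty {X = inside ∷ _}  _          = zero , here
¬emptyᵇ⇒nonempty {X = outside ∷ X} X-nonempty =
  let x , x∈X = ¬emptyᵇ⇒nonempty X-nonempty in suc x , there x∈X

initialSegments : Family n
initialSegments []            = true
initialSegments (inside ∷ X)  = initialSegments X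
initialSegments (outside ∷ X) = emptyᵇ X

size-initialSegments : size {n} initialSegments ≡ suc n
size-initialSegments {zero}  = refl
size-initialSegments {suc n} = begin
  size {suc n} initialSegments                      ≡⟨ size-∷ {n} initialSegments ⟩
  size {n} initialSegments + size {n} emptyᵇ        ≡⟨ cong₂ _+_ (size-initialSegments {n}) (size-emptyᵇ {n}) ⟩
  suc n + 1                                         ≡⟨ +-comm (suc n) 1 ⟩
  suc (suc n)                                       ∎
  where open ≡-Reasoning

⊥∈initialSegments : ⊥ {n} ∈F initialSegments
⊥∈initialSegments {zero}  = refl
⊥∈initialSegments {suc n} = emptyᵇ-⊥ {n}

⊤∈initialSegments : ⊤ {n} ∈F initialSegments
⊤∈initialSegments {zero}  = refl
⊤∈initialSegments {suc n} = ⊤∈initialSegments {n}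

initialSegments-total : X ∈F initialSegments → Y ∈F initialSegments → X ⊆ Y ⊎ Y ⊆ X
initialSegments-total {X = []}          {[]}          _   _   = inj₁ ⊆-refl
initialSegments-total {X = inside ∷ X}  {inside ∷ Y}  X∈F Y∈F =
  Sum.map s⊆s s⊆s (initialSegments-total X∈F Y∈F)
initialSegments-total {X = inside ∷ X}  {outside ∷ Y} _   Y∈F = inj₂ (out⊆ (emptyᵇ⇒⊆ Y∈F))
initialSegments-total {X = outside ∷ X} {_ ∷ Y}       X∈F _   = inj₁ (out⊆ (emptyᵇ⇒⊆ X∈F))

initialSegments-split : ∀ {S} → ¬ S ∈F initialSegments {n} →
                        ∃₂ λ A C → A ∈F initialSegments × C ∈F initialSegments × A ⊆ S × A ⊆ C × S ∥ C
initialSegments-split {S = []} S∉F = contradiction refl S∉F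
initialSegments-split {S = inside ∷ S} S∉F =
  let A , C , A∈F , C∈F , A⊆S , A⊆C , S∥C = initialSegments-split S∉F
  in  inside ∷ A , inside ∷ C , A∈F , C∈F , s⊆s A⊆S , s⊆s A⊆C , ∷-∥ S∥C
initialSegments-split {suc n} {S = outside ∷ S} S∉F =
  ⊥ , ⁅ zero ⁆ , ⊥∈initialSegments {suc n} , ⊥∈initialSegments {n} , ⊥⊆ , ⊥⊆ , S⊈⁅0⁆ , ⁅0⁆⊈S
  where
  ⁅0⁆⊈S : ⁅ zero ⁆ ⊈ outside ∷ S
  ⁅0⁆⊈S ⁅0⁆⊆S with () ← ⁅0⁆⊆S here

  S⊈⁅0⁆ : outside ∷ S ⊈ ⁅ zero ⁆
  S⊈⁅0⁆ S⊆⁅0⁆ with x , x∈S ← ¬emptyᵇ⇒nonempty S∉F | S⊆⁅0⁆ (there x∈S)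
  ... | there x∈⊥ = ∉⊥ x∈⊥

initialSegments-saturated : Saturated (initialSegments {n})
initialSegments-saturated {n} = D₂-free , extensions
  where
  D₂-free : ¬ InducedD₂ initialSegments
  D₂-free δ = [ proj₁ left∥right , proj₂ left∥right ] (initialSegments-total left∈F right∈F)
    where open Diamond (InducedD₂⇒Diamond {F = initialSegments} δ)

  extensions : ∀ G → initialSegments ⊊F G → InducedD₂ G
  extensions G (⊆G , S , S∈G , S∉F)
    with A , C , A∈F , C∈F , A⊆S , A⊆C , S∥C ← initialSegments-split S∉F =
    Diamond⇒InducedD₂ record
      { bottom = A ; left = S ; right = C ; top = ⊤
      ; bottom∈F = ⊆G A A∈F ; left∈F = S∈G ; right∈F = ⊆G C C∈F ; top∈F = ⊆G ⊤ (⊤∈initialSegments {n})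
      ; bottom⊆left = A⊆S ; bottom⊆right = A⊆C ; left⊆top = ⊆⊤ ; right⊆top = ⊆⊤
      ; left∥right = S∥C
      }

theorem5 : (n : ℕ) → 2 ≤ n →
    ((F : Family n) → Saturated F → ⌈log₂ n ⌉ ≤ size F) ×
    Σ (Family n) (λ F → Saturated F × size F ≤ n + 1)
theorem5 n _ =
  (λ F → ⌈log₂n⌉≤size) ,
  initialSegments , initialSegments-saturated , ≤-reflexive (trans size-initialSegments (+-comm 1 n))
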